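{- Let $n$ be a positive integer and let $f,\theta,D$ be positive numbers and $c\geq 1$ with $c\geq 4(D+2)\theta$, and let $a\geq 2(D+1)f$. If $G$ is a $(c/(an),\theta)$-bijumbled graph with $an$ vertices, then there exists a non-empty subgraph $H$ of $G$ that is $(n,f,D)$-expanding.
   Context: For a graph $G$ and $X\subseteq V(G)$, $N_G(X)$ denotes the set of all vertices of $G$ that share an edge with some vertex of $X$. A graph $G$ is $(n,a,b)$-expanding if for all $X\subseteq V(G)$ with $|X|\leq a(n-1)$ we have $|N_G(X)|\geq b|X|$. For disjoint vertex sets $X,Y$, $e_G(X,Y)$ is the number of edges of $G$ between $X$ and $Y$. A graph $G$ on $N$ vertices is $(p,\theta)$-bijumbled if for all disjoint $X,Y\subseteq V(G)$ with $|X|\leq|Y|\leq pN|X|$ we have $\big|e_G(X,Y)-p|X||Y|\big|\leq\theta\sqrt{|X||Y|}$.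
   Formalization: The positive numbers f, θ, D and c are rational, so the bijumbledness parameter $c/(an)$ is rational as well. -}

module Defs where

open import Data.Bool using (Bool; true; false; _∧_; if_then_else_)
open import Data.Nat as ℕ using (ℕ; zero; suc; _∸_)
open import Data.Fin using (Fin; zero; suc)
open import Data.Fin.Subset using (Subset; _∈_; _⊆_; ∣_∣; Nonempty)
open import Data.Vec using (Vec; lookup; tabulate)
open import Data.Integer using (+_)
open import Data.Rational using (ℚ; _≤_; _*_; _-_; _/_)
open import Data.Empty using (⊥)
open import Data.Product using (_×_; Σ)
open import Relation.Binary.PropositionalEquality using (_≡_)

ℕ→ℚ : ℕ → ℚ
ℕ→ℚ k = (+ k) / 1

sumF : ∀ {N} → (Fin N → ℕ) → ℕ
sumF {zero} g = 0
sumF {suc N} g = g zero ℕ.+ sumF (λ i → g (suc i))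

anyF : ∀ {N} → (Fin N → Bool) → Bool
anyF {zero} g = false
anyF {suc N} g = if g zero then true else anyF (λ i → g (suc i))

record Graph (N : ℕ) : Set where
  field
    adj    : Fin N → Fin N → Bool
    sym    : ∀ i j → adj i j ≡ adj j i
    irrefl : ∀ i → adj i i ≡ false
open Graph public

Disjoint : ∀ {N} → Subset N → Subset N → Set
Disjoint {N} X Y = ∀ (i : Fin N) → i ∈ X → i ∈ Y → ⊥

-- e_G(X,Y): number of edges with one end in X and the other in Y
-- (X, Y disjoint, so this counts ordered pairs (x,y), x ∈ X, y ∈ Y, xy ∈ E)
eG : ∀ {N} → Graph N → Subset N → Subset N → ℕ
eG G X Y = sumF (λ i → sumF (λ j →
  if lookup X i ∧ lookup Y j ∧ adj G i j then 1 else 0))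

-- (p,θ)-bijumbled, with the inequality |e - p|X||Y|| ≤ θ √(|X||Y|)
-- written in the equivalent squared form (e - p|X||Y|)² ≤ θ² |X||Y|
-- (both sides nonnegative since θ > 0).
Bijumbled : ∀ {N} → Graph N → ℚ → ℚ → Set
Bijumbled {N} G p θ =
  ∀ (X Y : Subset N) → Disjoint X Y →
  ℕ→ℚ ∣ X ∣ ≤ ℕ→ℚ ∣ Y ∣ →
  ℕ→ℚ ∣ Y ∣ ≤ p * ℕ→ℚ N * ℕ→ℚ ∣ X ∣ →
  let d = ℕ→ℚ (eG G X Y) - p * ℕ→ℚ ∣ X ∣ * ℕ→ℚ ∣ Y ∣ in
  d * d ≤ θ * θ * (ℕ→ℚ ∣ X ∣ * ℕ→ℚ ∣ Y ∣)

record Subgraph {N : ℕ} (G : Graph N) : Set where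
  field
    W       : Subset N
    adjH    : Fin N → Fin N → Bool
    symH    : ∀ i j → adjH i j ≡ adjH j i
    edgesH  : ∀ i j → adjH i j ≡ true → (adj G i j ≡ true) × (i ∈ W) × (j ∈ W)
open Subgraph public

nbhd : ∀ {N} {G : Graph N} → Subgraph G → Subset N → Subset N
nbhd H X = tabulate (λ j → anyF (λ i → lookup X i ∧ adjH H i j))

Expanding : ∀ {N} {G : Graph N} → Subgraph G → ℕ → ℚ → ℚ → Set
Expanding {N} H n a b =
  ∀ (X : Subset N) → X ⊆ W H →
  ℕ→ℚ ∣ X ∣ ≤ a * ℕ→ℚ (n ∸ 1) →
  b * ℕ→ℚ ∣ X ∣ ≤ ℕ→ℚ ∣ nbhd H X ∣

{-# OPTIONS --safe #-}
-- Remove from G, one after another, vertex sets X that fail to expand in what is left of G.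
-- With K = 4(D+1), the removed set B keeps |N(B) ∖ B| ≤ D|B| and K|B| < N. Indeed, for
-- S = B ∪ X the first property persists, and since |X| ≤ f(n-1) ≤ N/(2(D+1)) we get
-- (D+1)|S| ≤ 3N/4, so the set Y of vertices outside S ∪ N(S) has 4|Y| ≥ N. There are no
-- edges between S and Y, and bijumbledness applied to edgeless pairs of sets of equal size m
-- gives p m ≤ θ, hence K m < N as K θ < c = p N. Taking m = min(|S|, |Y|) and using
-- K|Y| ≥ 4|Y| ≥ N forces K|S| < N. As B grows strictly, the process stops, and G − B is
-- nonempty because |B| < N.
module Submission where

open import Defs
open import Data.Nat using (ℕ; _≥_)
open import Data.Rational using (ℚ; _≤_; _<_; _*_; _+_; 0ℚ; 1ℚ)
open import Data.Fin.Subset using (Nonempty)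
open import Relation.Binary.PropositionalEquality using (_≡_)
open import Data.Product using (Σ; _×_)

open import Data.Bool using (Bool; true; false; _∧_; if_then_else_)
import Data.Bool.Properties as BoolP
import Data.Nat as ℕ
import Data.Nat.Properties as ℕP
import Data.Nat.Coprimality as Coprime
import Data.Integer as ℤ
import Data.Integer.Properties as ℤP
open import Data.Rational using (mkℚ; _-_; -_; *≤*; NonNegative; Positive; positive; nonNegative)
import Data.Rational.Properties as ℚP
open import Data.Rational.Solver using (module +-*-Solver)
open import Data.Fin using (Fin; zero; suc)
open import Data.Fin.Subset using (Subset; _∈_; _⊆_; _⊂_; _⊃_; ∣_∣; _∪_; _∩_; ∁; ⊥; inside; outside)
import Data.Fin.Subset.Properties as SP
open import Data.Fin.Subset.Induction using (⊃-wellFounded; Acc; acc)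
open import Data.Vec using ([]; _∷_; lookup; tabulate; here)
import Data.Vec.Properties as VecP
open import Data.Product using (_,_; proj₁; proj₂; ∃; ∃-syntax)
open import Data.Sum using (_⊎_; inj₁; inj₂; map₂; [_,_]′)
open import Level using (Level)
open import Relation.Binary.PropositionalEquality as ≡ using (_≢_; refl; cong; cong₂; subst; subst₂)
open import Relation.Nullary using (¬_; Dec; yes; no; contradiction)
open import Relation.Nullary.Decidable using (_×-dec_)

private
  variable
    ℓ : Level
    n : ℕ

ℕ→ℚ≡mkℚ : ∀ k → ℕ→ℚ k ≡ mkℚ (ℤ.+ k) 0 (Coprime.sym (Coprime.1-coprimeTo k))
ℕ→ℚ≡mkℚ k = ℚP.normalize-coprime _

ℕ→ℚ-mono-≤ : ∀ {j k} → j ℕ.≤ k → ℕ→ℚ j ≤ ℕ→ℚ k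
ℕ→ℚ-mono-≤ {j} {k} j≤k rewrite ℕ→ℚ≡mkℚ j | ℕ→ℚ≡mkℚ k =
  *≤* (subst₂ ℤ._≤_ (≡.sym (ℤP.*-identityʳ (ℤ.+ j))) (≡.sym (ℤP.*-identityʳ (ℤ.+ k))) (ℤ.+≤+ j≤k))

ℕ→ℚ-homo-+ : ∀ j k → ℕ→ℚ (j ℕ.+ k) ≡ ℕ→ℚ j + ℕ→ℚ k
ℕ→ℚ-homo-+ j k rewrite ℕ→ℚ≡mkℚ j | ℕ→ℚ≡mkℚ k =
  ℚP./-cong {ℤ.+ (j ℕ.+ k)} {1} {ℤ.+ j ℤ.* ℤ.+ 1 ℤ.+ ℤ.+ k ℤ.* ℤ.+ 1} {1}
    (cong₂ ℤ._+_ (≡.sym (ℤP.*-identityʳ (ℤ.+ j))) (≡.sym (ℤP.*-identityʳ (ℤ.+ k)))) refl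

ℕ→ℚ-nonNeg : ∀ k → 0ℚ ≤ ℕ→ℚ k
ℕ→ℚ-nonNeg k = ℕ→ℚ-mono-≤ {0} {k} ℕ.z≤n

ℕ→ℚ-nonNegative : ∀ k → NonNegative (ℕ→ℚ k)
ℕ→ℚ-nonNegative k = ℚP.normalize-nonNeg k 1

ℕ→ℚ-pos : ∀ k → 0ℚ < ℕ→ℚ (ℕ.suc k)
ℕ→ℚ-pos k = ℚP.positive⁻¹ _ {{ℚP.normalize-pos (ℕ.suc k) 1}}

≤⇒≯ : ∀ {x y} → x ≤ y → ¬ (y < x)
≤⇒≯ x≤y y<x = ℚP.<-irrefl refl (ℚP.<-≤-trans y<x x≤y)

x*x≤y*y⇒x≤y : ∀ {x y} → 0ℚ ≤ y → x * x ≤ y * y → x ≤ y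
x*x≤y*y⇒x≤y {x} {y} 0≤y x²≤y² = ℚP.≮⇒≥ λ y<x → ≤⇒≯ x²≤y² (ℚP.≤-<-trans
  (ℚP.*-monoʳ-≤-nonNeg y {{nonNegative 0≤y}} (ℚP.<⇒≤ y<x))
  (ℚP.*-monoʳ-<-pos x {{positive (ℚP.≤-<-trans 0≤y y<x)}} y<x))

+-cancelˡ-≤ : ∀ x {y z} → x + y ≤ x + z → y ≤ z
+-cancelˡ-≤ x {y} {z} x+y≤x+z = subst₂ _≤_ (cancel y) (cancel z) (ℚP.+-monoʳ-≤ (- x) x+y≤x+z)
  where
  open +-*-Solver
  cancel : ∀ w → - x + (x + w) ≡ w
  cancel w = solve 2 (λ x w → :- x :+ (x :+ w) := w) refl x w

≤-scaled : ∀ {r} k → 1ℚ ≤ r → ℕ→ℚ k ≤ r * ℕ→ℚ k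
≤-scaled {r} k 1≤r = begin
  ℕ→ℚ k       ≡⟨ ℚP.*-identityˡ (ℕ→ℚ k) ⟨
  1ℚ * ℕ→ℚ k  ≤⟨ ℚP.*-monoʳ-≤-nonNeg (ℕ→ℚ k) {{ℕ→ℚ-nonNegative k}} 1≤r ⟩
  r * ℕ→ℚ k   ∎
  where open ℚP.≤-Reasoning

∣p∪q∣≤∣p∣+∣q∣ : ∀ (p q : Subset n) → ∣ p ∪ q ∣ ℕ.≤ ∣ p ∣ ℕ.+ ∣ q ∣
∣p∪q∣≤∣p∣+∣q∣ []            []            = ℕ.z≤n
∣p∪q∣≤∣p∣+∣q∣ (inside ∷ p)  (inside ∷ q)  =
  ℕ.s≤s (ℕP.≤-trans (∣p∪q∣≤∣p∣+∣q∣ p q) (ℕP.+-monoʳ-≤ ∣ p ∣ (ℕP.n≤1+n ∣ q ∣)))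
∣p∪q∣≤∣p∣+∣q∣ (inside ∷ p)  (outside ∷ q) = ℕ.s≤s (∣p∪q∣≤∣p∣+∣q∣ p q)
∣p∪q∣≤∣p∣+∣q∣ (outside ∷ p) (inside ∷ q)  =
  ℕP.≤-trans (ℕ.s≤s (∣p∪q∣≤∣p∣+∣q∣ p q)) (ℕP.≤-reflexive (≡.sym (ℕP.+-suc ∣ p ∣ ∣ q ∣)))
∣p∪q∣≤∣p∣+∣q∣ (outside ∷ p) (outside ∷ q) = ∣p∪q∣≤∣p∣+∣q∣ p q

∣p∪q∣≡∣p∣+∣q∣ : ∀ (p q : Subset n) → q ⊆ ∁ p → ∣ p ∪ q ∣ ≡ ∣ p ∣ ℕ.+ ∣ q ∣
∣p∪q∣≡∣p∣+∣q∣ []            []            _    = refl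
∣p∪q∣≡∣p∣+∣q∣ (inside ∷ p)  (inside ∷ q)  q⊆∁p with () ← q⊆∁p here
∣p∪q∣≡∣p∣+∣q∣ (inside ∷ p)  (outside ∷ q) q⊆∁p = cong ℕ.suc (∣p∪q∣≡∣p∣+∣q∣ p q (SP.drop-∷-⊆ q⊆∁p))
∣p∪q∣≡∣p∣+∣q∣ (outside ∷ p) (inside ∷ q)  q⊆∁p =
  ≡.trans (cong ℕ.suc (∣p∪q∣≡∣p∣+∣q∣ p q (SP.drop-∷-⊆ q⊆∁p))) (≡.sym (ℕP.+-suc ∣ p ∣ ∣ q ∣))
∣p∪q∣≡∣p∣+∣q∣ (outside ∷ p) (outside ∷ q) q⊆∁p = ∣p∪q∣≡∣p∣+∣q∣ p q (SP.drop-∷-⊆ q⊆∁p)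

∣p∣+∣∁p∣≡n : ∀ (p : Subset n) → ∣ p ∣ ℕ.+ ∣ ∁ p ∣ ≡ n
∣p∣+∣∁p∣≡n p = ≡.trans (cong (∣ p ∣ ℕ.+_) (SP.∣∁p∣≡n∸∣p∣ p)) (ℕP.m+[n∸m]≡n (SP.∣p∣≤n p))

subset-of-size : ∀ (p : Subset n) {m} → m ℕ.≤ ∣ p ∣ → ∃[ q ] q ⊆ p × ∣ q ∣ ≡ m
subset-of-size {n} p {ℕ.zero} _ = ⊥ , SP.⊆-min p , SP.∣⊥∣≡0 n
subset-of-size (inside ∷ p) {ℕ.suc m} (ℕ.s≤s m≤∣p∣) =
  let q , q⊆p , ∣q∣≡m = subset-of-size p m≤∣p∣ in inside ∷ q , SP.s⊆s q⊆p , cong ℕ.suc ∣q∣≡m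
subset-of-size (outside ∷ p) {ℕ.suc m} m≤∣p∣ =
  let q , q⊆p , ∣q∣≡m = subset-of-size p m≤∣p∣ in outside ∷ q , SP.s⊆s q⊆p , ∣q∣≡m

∣p∣>0⇒Nonempty : ∀ (p : Subset n) → 0 ℕ.< ∣ p ∣ → Nonempty p
∣p∣>0⇒Nonempty {n} p ∣p∣>0 with SP.nonempty? p
... | yes p≢∅ = p≢∅
... | no  p≡∅ = contradiction (≡.trans (cong ∣_∣ (SP.Empty-unique p≡∅)) (SP.∣⊥∣≡0 n)) (ℕP.>⇒≢ ∣p∣>0)

p⊂p∪q : ∀ {p q : Subset n} → q ⊆ ∁ p → Nonempty q → p ⊂ p ∪ q
p⊂p∪q {q = q} q⊆∁p (x , x∈q) = SP.p⊆p∪q q , x , SP.x∈p∪q⁺ (inj₂ x∈q) , SP.x∈∁p⇒x∉p (q⊆∁p x∈q)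

grow-until : ∀ {P Q : Subset n → Set ℓ} →
  (∀ {B} → P B → Q B ⊎ ∃[ B′ ] B ⊂ B′ × P B′) →
  ∀ {B} → P B → ∃[ B ] P B × Q B
grow-until {P = P} {Q} step = go (⊃-wellFounded _)
  where
  go : ∀ {B} → Acc _⊃_ B → P B → ∃[ B ] P B × Q B
  go (acc rec) PB with step PB
  ... | inj₁ QB                = _ , PB , QB
  ... | inj₂ (B′ , B⊂B′ , PB′) = go (rec B⊂B′) PB′

∧≡true⁻ : ∀ {x y} → x ∧ y ≡ true → x ≡ true × y ≡ true
∧≡true⁻ {true} {true} _ = refl , refl

anyF≡true⁺ : ∀ (g : Fin n → Bool) i → g i ≡ true → anyF g ≡ true
anyF≡true⁺ g zero    gi≡true rewrite gi≡true = refl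
anyF≡true⁺ g (suc i) gi≡true with g zero
... | true  = refl
... | false = anyF≡true⁺ (λ k → g (suc k)) i gi≡true

anyF≡true⁻ : ∀ (g : Fin n → Bool) → anyF g ≡ true → ∃[ i ] g i ≡ true
anyF≡true⁻ {ℕ.zero}  g ()
anyF≡true⁻ {ℕ.suc n} g any≡true with g zero in g0≡true
... | true  = zero , g0≡true
... | false = let i , gi≡true = anyF≡true⁻ (λ k → g (suc k)) any≡true in suc i , gi≡true

sumF≡0 : ∀ (g : Fin n → ℕ) → (∀ i → g i ≡ 0) → sumF g ≡ 0
sumF≡0 {ℕ.zero}  g _   = refl
sumF≡0 {ℕ.suc n} g g≡0 rewrite g≡0 zero = sumF≡0 (λ i → g (suc i)) (λ i → g≡0 (suc i))

∈⇒lookup : ∀ {X : Subset n} {i} → i ∈ X → lookup X i ≡ true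
∈⇒lookup = VecP.[]=⇒lookup

lookup⇒∈ : ∀ {X : Subset n} {i} → lookup X i ≡ true → i ∈ X
lookup⇒∈ {X = X} {i} = VecP.lookup⇒[]= i X

neighbours : (Fin n → Fin n → Bool) → Subset n → Subset n
neighbours A X = tabulate (λ j → anyF (λ i → lookup X i ∧ A i j))

∈-neighbours⁺ : ∀ (A : Fin n → Fin n → Bool) {X i j} → i ∈ X → A i j ≡ true → j ∈ neighbours A X
∈-neighbours⁺ A {X} {i} {j} i∈X Aij≡true = lookup⇒∈ (≡.trans (VecP.lookup∘tabulate _ j)
  (anyF≡true⁺ (λ k → lookup X k ∧ A k j) i (cong₂ _∧_ (∈⇒lookup i∈X) Aij≡true)))

∈-neighbours⁻ : ∀ (A : Fin n → Fin n → Bool) {X j} → j ∈ neighbours A X → ∃[ i ] i ∈ X × A i j ≡ true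
∈-neighbours⁻ A {X} {j} j∈NX =
  let i , Xi∧Aij = anyF≡true⁻ (λ k → lookup X k ∧ A k j)
                     (≡.trans (≡.sym (VecP.lookup∘tabulate _ j)) (∈⇒lookup j∈NX))
      Xi , Aij≡true = ∧≡true⁻ Xi∧Aij
  in i , lookup⇒∈ Xi , Aij≡true

_∖_ : (G : Graph n) → Subset n → Subgraph G
G ∖ B = record
  { W      = ∁ B
  ; adjH   = λ i j → adj G i j ∧ (lookup (∁ B) i ∧ lookup (∁ B) j)
  ; symH   = λ i j → cong₂ _∧_ (sym G i j) (BoolP.∧-comm (lookup (∁ B) i) (lookup (∁ B) j))
  ; edgesH = λ i j edge →
      let Gij , ends = ∧≡true⁻ edge ; i∉B , j∉B = ∧≡true⁻ ends
      in Gij , lookup⇒∈ i∉B , lookup⇒∈ j∉B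
  }

boundary : Graph n → Subset n → Subset n
boundary G S = neighbours (adj G) S ∩ ∁ S

exterior : Graph n → Subset n → Subset n
exterior G S = ∁ (S ∪ neighbours (adj G) S)

NoEdgesBetween : Graph n → Subset n → Subset n → Set
NoEdgesBetween G X Y = ∀ {i j} → i ∈ X → j ∈ Y → adj G i j ≡ false

module _ (G : Graph n) where

  ∈-nbhd-∖⁺ : ∀ {B X i j} → X ⊆ ∁ B → i ∈ X → adj G i j ≡ true → j ∈ ∁ B → j ∈ nbhd (G ∖ B) X
  ∈-nbhd-∖⁺ {B} X⊆∁B i∈X Gij j∉B = ∈-neighbours⁺ (adjH (G ∖ B)) i∈X
    (cong₂ _∧_ Gij (cong₂ _∧_ (∈⇒lookup (X⊆∁B i∈X)) (∈⇒lookup j∉B)))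

  boundary-∪ : ∀ {B X} → X ⊆ ∁ B → boundary G (B ∪ X) ⊆ boundary G B ∪ nbhd (G ∖ B) X
  boundary-∪ {B} {X} X⊆∁B j∈∂S =
    let j∈NS , j∉S = SP.x∈p∩q⁻ (neighbours (adj G) (B ∪ X)) (∁ (B ∪ X)) j∈∂S
        i , i∈S , Gij = ∈-neighbours⁻ (adj G) j∈NS
        j∉B = SP.p⊆q⇒∁p⊇∁q (SP.p⊆p∪q X) j∉S
    in [ (λ i∈B → SP.x∈p∪q⁺ (inj₁ (SP.x∈p∩q⁺ (∈-neighbours⁺ (adj G) i∈B Gij , j∉B))))
       , (λ i∈X → SP.x∈p∪q⁺ (inj₂ (∈-nbhd-∖⁺ X⊆∁B i∈X Gij j∉B)))
       ]′ (SP.x∈p∪q⁻ B X i∈S)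

  ∪-neighbours⊆∪-boundary : ∀ S → S ∪ neighbours (adj G) S ⊆ S ∪ boundary G S
  ∪-neighbours⊆∪-boundary S {j} j∈S∪NS with SP.x∈p∪q⁻ S _ j∈S∪NS | j SP.∈? S
  ... | inj₁ j∈S  | _       = SP.x∈p∪q⁺ (inj₁ j∈S)
  ... | inj₂ _    | yes j∈S = SP.x∈p∪q⁺ (inj₁ j∈S)
  ... | inj₂ j∈NS | no  j∉S = SP.x∈p∪q⁺ (inj₂ (SP.x∈p∩q⁺ (j∈NS , SP.x∉p⇒x∈∁p j∉S)))

  exterior-disjoint : ∀ S → Disjoint S (exterior G S)
  exterior-disjoint S i i∈S i∈ext = SP.x∈∁p⇒x∉p i∈ext (SP.x∈p∪q⁺ (inj₁ i∈S))

  exterior-edgeless : ∀ S → NoEdgesBetween G S (exterior G S)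
  exterior-edgeless S {i} {j} i∈S j∈ext with adj G i j in Gij
  ... | false = refl
  ... | true  = contradiction (SP.x∈p∪q⁺ (inj₂ (∈-neighbours⁺ (adj G) i∈S Gij))) (SP.x∈∁p⇒x∉p j∈ext)

  eG≡0 : ∀ {X Y} → NoEdgesBetween G X Y → eG G X Y ≡ 0
  eG≡0 {X} {Y} none = sumF≡0 _ (λ i → sumF≡0 _ (λ j → no-edge i j))
    where
    no-edge : ∀ i j → (if lookup X i ∧ lookup Y j ∧ adj G i j then 1 else 0) ≡ 0
    no-edge i j with lookup X i in Xi | lookup Y j in Yj
    ... | false | _     = refl
    ... | true  | false = refl
    ... | true  | true  rewrite none (lookup⇒∈ Xi) (lookup⇒∈ Yj) = refl

-- Expanding H n a b is, by definition, ExpandsUpTo H (a * ℕ→ℚ (n ∸ 1)) b.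
ExpandsUpTo : ∀ {G : Graph n} → Subgraph G → ℚ → ℚ → Set
ExpandsUpTo {n} H σ b =
  ∀ (X : Subset n) → X ⊆ W H → ℕ→ℚ ∣ X ∣ ≤ σ → b * ℕ→ℚ ∣ X ∣ ≤ ℕ→ℚ ∣ nbhd H X ∣

Contracting : ∀ {G : Graph n} → Subgraph G → ℚ → ℚ → Subset n → Set
Contracting H σ b X = X ⊆ W H × ℕ→ℚ ∣ X ∣ ≤ σ × ℕ→ℚ ∣ nbhd H X ∣ < b * ℕ→ℚ ∣ X ∣

expands-or-contracting : ∀ {G : Graph n} (H : Subgraph G) σ b →
  ExpandsUpTo H σ b ⊎ ∃ (Contracting H σ b)
expands-or-contracting H σ b = decide (SP.anySubset? (λ X →
  X SP.⊆? W H ×-dec ℕ→ℚ ∣ X ∣ ℚP.≤? σ ×-dec ℕ→ℚ ∣ nbhd H X ∣ ℚP.<? b * ℕ→ℚ ∣ X ∣))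
  where
  decide : Dec (∃ (Contracting H σ b)) → ExpandsUpTo H σ b ⊎ ∃ (Contracting H σ b)
  decide (yes contracting) = inj₂ contracting
  decide (no ¬contracting) =
    inj₁ λ X X⊆W small → ℚP.≮⇒≥ (λ shrinks → ¬contracting (X , X⊆W , small , shrinks))

contracting-nonempty : ∀ {G : Graph n} (H : Subgraph G) {σ} b {X} → Contracting H σ b X → Nonempty X
contracting-nonempty H b {X} (_ , _ , shrinks) = ∣p∣>0⇒Nonempty X (ℕP.n≢0⇒n>0 ∣X∣≢0)
  where
  ∣X∣≢0 : ∣ X ∣ ≢ 0
  ∣X∣≢0 ∣X∣≡0 = ≤⇒≯ (ℕ→ℚ-nonNeg ∣ nbhd H X ∣)
    (ℚP.<-≤-trans (subst (λ k → ℕ→ℚ ∣ nbhd H X ∣ < b * ℕ→ℚ k) ∣X∣≡0 shrinks) (ℚP.≤-reflexive (ℚP.*-zeroʳ b)))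

-- The inequality of Bijumbled as a function of e(X,Y), |X| and |Y|, so that these can be rewritten.
JumbleBound : ℚ → ℚ → ℕ → ℕ → ℕ → Set
JumbleBound p θ e x y =
  (ℕ→ℚ e - p * ℕ→ℚ x * ℕ→ℚ y) * (ℕ→ℚ e - p * ℕ→ℚ x * ℕ→ℚ y) ≤ θ * θ * (ℕ→ℚ x * ℕ→ℚ y)

empty-pair-bound : ∀ p {θ} m → 0ℚ ≤ θ → JumbleBound p θ 0 m m → p * ℕ→ℚ m ≤ θ
empty-pair-bound p ℕ.zero    0≤θ _ = ℚP.≤-trans (ℚP.≤-reflexive (ℚP.*-zeroʳ p)) 0≤θ
empty-pair-bound p {θ} (ℕ.suc m) 0≤θ bound =
  x*x≤y*y⇒x≤y 0≤θ (ℚP.*-cancelʳ-≤-pos (x * x) (subst (_≤ θ * θ * (x * x)) square bound))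
  where
  open +-*-Solver
  x : ℚ
  x = ℕ→ℚ (ℕ.suc m)
  instance
    x*x-pos : Positive (x * x)
    x*x-pos = ℚP.pos*pos⇒pos x {{positive (ℕ→ℚ-pos m)}} x {{positive (ℕ→ℚ-pos m)}}
  square : (0ℚ - p * x * x) * (0ℚ - p * x * x) ≡ p * x * (p * x) * (x * x)
  square = solve 2 (λ p x → (con 0ℚ :- p :* x :* x) :* (con 0ℚ :- p :* x :* x)
                            := p :* x :* (p :* x) :* (x :* x)) refl p x

bijumbled-edgeless : ∀ (G : Graph n) p {θ} → Bijumbled G p θ → 0ℚ ≤ θ → 1ℚ ≤ p * ℕ→ℚ n →
  ∀ {X Y m} → Disjoint X Y → NoEdgesBetween G X Y → m ℕ.≤ ∣ X ∣ → m ℕ.≤ ∣ Y ∣ → p * ℕ→ℚ m ≤ θ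
bijumbled-edgeless {n} G p {θ} bij 0≤θ 1≤pn {X} {Y} {m} X∩Y≡∅ none m≤∣X∣ m≤∣Y∣ =
  let X′ , X′⊆X , ∣X′∣≡m = subset-of-size X m≤∣X∣
      Y′ , Y′⊆Y , ∣Y′∣≡m = subset-of-size Y m≤∣Y∣
      bound = bij X′ Y′ (λ i i∈X′ i∈Y′ → X∩Y≡∅ i (X′⊆X i∈X′) (Y′⊆Y i∈Y′))
        (ℚP.≤-reflexive (cong ℕ→ℚ (≡.trans ∣X′∣≡m (≡.sym ∣Y′∣≡m))))
        (subst₂ (λ y x → ℕ→ℚ y ≤ p * ℕ→ℚ n * ℕ→ℚ x) (≡.sym ∣Y′∣≡m) (≡.sym ∣X′∣≡m) (≤-scaled m 1≤pn))
      no-edges = eG≡0 G (λ i∈X′ j∈Y′ → none (X′⊆X i∈X′) (Y′⊆Y j∈Y′))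
  in empty-pair-bound p m 0≤θ
       (subst₂ (JumbleBound p θ 0) ∣X′∣≡m ∣Y′∣≡m (subst (λ e → JumbleBound p θ e ∣ X′ ∣ ∣ Y′ ∣) no-edges bound))

module Peeling {N : ℕ} (G : Graph N) (p θ D σ : ℚ)
  (bij : Bijumbled G p θ) (0≤θ : 0ℚ ≤ θ) (0≤D : 0ℚ ≤ D) (1≤pN : 1ℚ ≤ p * ℕ→ℚ N)
  (Kθ<pN : ℕ→ℚ 4 * (D + 1ℚ) * θ < p * ℕ→ℚ N)
  (σ-small : ℕ→ℚ 2 * (D + 1ℚ) * σ ≤ ℕ→ℚ N)
  where

  open ℚP.≤-Reasoning
  open +-*-Solver

  K : ℚ
  K = ℕ→ℚ 4 * (D + 1ℚ)

  1≤D+1 : 1ℚ ≤ D + 1ℚ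
  1≤D+1 = ℚP.+-monoˡ-≤ 1ℚ 0≤D

  4≤K : ℕ→ℚ 4 ≤ K
  4≤K = ℚP.*-monoˡ-≤-nonNeg (ℕ→ℚ 4) 1≤D+1

  1≤K : 1ℚ ≤ K
  1≤K = ℚP.≤-trans (ℕ→ℚ-mono-≤ {1} {4} (ℕ.s≤s ℕ.z≤n)) 4≤K

  instance
    D+1-nonNeg : NonNegative (D + 1ℚ)
    D+1-nonNeg = nonNegative (ℚP.≤-trans (ℚP.<⇒≤ (ℚP.positive⁻¹ 1ℚ)) 1≤D+1)
    K-nonNeg : NonNegative K
    K-nonNeg = ℚP.nonNeg*nonNeg⇒nonNeg (ℕ→ℚ 4) (D + 1ℚ)
    2[D+1]-nonNeg : NonNegative (ℕ→ℚ 2 * (D + 1ℚ))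
    2[D+1]-nonNeg = ℚP.nonNeg*nonNeg⇒nonNeg (ℕ→ℚ 2) (D + 1ℚ)

  1≰0 : ¬ (1ℚ ≤ 0ℚ)
  1≰0 1≤0 = ≤⇒≯ 1≤0 (ℚP.positive⁻¹ 1ℚ)

  0≤p : 0ℚ ≤ p
  0≤p = ℚP.≮⇒≥ λ p<0 → 1≰0 (begin
    1ℚ          ≤⟨ 1≤pN ⟩
    p * ℕ→ℚ N   ≤⟨ ℚP.*-monoʳ-≤-nonNeg (ℕ→ℚ N) {{ℕ→ℚ-nonNegative N}} (ℚP.<⇒≤ p<0) ⟩
    0ℚ * ℕ→ℚ N  ≡⟨ ℚP.*-zeroˡ (ℕ→ℚ N) ⟩
    0ℚ          ∎)

  0<N : 0ℚ < ℕ→ℚ N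
  0<N = ℚP.≰⇒> λ N≤0 → 1≰0 (begin
    1ℚ          ≤⟨ 1≤pN ⟩
    p * ℕ→ℚ N   ≡⟨ cong (p *_) (ℚP.≤-antisym N≤0 (ℕ→ℚ-nonNeg N)) ⟩
    p * 0ℚ      ≡⟨ ℚP.*-zeroʳ p ⟩
    0ℚ          ∎)

  edgeless-small : ∀ {X Y m} → Disjoint X Y → NoEdgesBetween G X Y →
    m ℕ.≤ ∣ X ∣ → m ℕ.≤ ∣ Y ∣ → K * ℕ→ℚ m < ℕ→ℚ N
  edgeless-small {m = m} X∩Y≡∅ none m≤∣X∣ m≤∣Y∣ = ℚP.≰⇒> λ N≤Km → ℚP.<-irrefl refl (begin-strict
    p * ℕ→ℚ N        ≤⟨ ℚP.*-monoˡ-≤-nonNeg p {{nonNegative 0≤p}} N≤Km ⟩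
    p * (K * ℕ→ℚ m)  ≡⟨ solve 3 (λ p K m → p :* (K :* m) := K :* (p :* m)) refl p K (ℕ→ℚ m) ⟩
    K * (p * ℕ→ℚ m)  ≤⟨ ℚP.*-monoˡ-≤-nonNeg K (bijumbled-edgeless G p bij 0≤θ 1≤pN X∩Y≡∅ none m≤∣X∣ m≤∣Y∣) ⟩
    K * θ            <⟨ Kθ<pN ⟩
    p * ℕ→ℚ N        ∎)

  Removable : Subset N → Set
  Removable B = ℕ→ℚ ∣ boundary G B ∣ ≤ D * ℕ→ℚ ∣ B ∣ × K * ℕ→ℚ ∣ B ∣ < ℕ→ℚ N

  removable-⊥ : Removable ⊥
  removable-⊥ =
      subst₂ (λ ∂ b → ℕ→ℚ ∂ ≤ D * ℕ→ℚ b) (≡.sym ∣∂⊥∣≡0) (≡.sym (SP.∣⊥∣≡0 N)) (ℚP.≤-reflexive (≡.sym (ℚP.*-zeroʳ D)))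
    , subst (λ b → K * ℕ→ℚ b < ℕ→ℚ N) (≡.sym (SP.∣⊥∣≡0 N)) (ℚP.≤-<-trans (ℚP.≤-reflexive (ℚP.*-zeroʳ K)) 0<N)
    where
    ∂⊥⊆⊥ : boundary G ⊥ ⊆ ⊥
    ∂⊥⊆⊥ j∈∂⊥ = let _ , i∈⊥ , _ = ∈-neighbours⁻ (adj G) (proj₁ (SP.x∈p∩q⁻ _ _ j∈∂⊥)) in contradiction i∈⊥ SP.∉⊥
    ∣∂⊥∣≡0 : ∣ boundary G ⊥ ∣ ≡ 0
    ∣∂⊥∣≡0 = ℕP.n≤0⇒n≡0 (ℕP.≤-trans (SP.p⊆q⇒∣p∣≤∣q∣ ∂⊥⊆⊥) (ℕP.≤-reflexive (SP.∣⊥∣≡0 N)))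

  removable⇒∁-nonempty : ∀ {B} → Removable B → Nonempty (∁ B)
  removable⇒∁-nonempty {B} (_ , K∣B∣<N) =
    ∣p∣>0⇒Nonempty (∁ B) (subst (0 ℕ.<_) (≡.sym (SP.∣∁p∣≡n∸∣p∣ B)) (ℕP.m<n⇒0<n∸m ∣B∣<N))
    where
    ∣B∣<N : ∣ B ∣ ℕ.< N
    ∣B∣<N = ℕP.≰⇒> λ N≤∣B∣ → ℚP.<-irrefl refl (begin-strict
      ℕ→ℚ N          ≤⟨ ℕ→ℚ-mono-≤ N≤∣B∣ ⟩
      ℕ→ℚ ∣ B ∣      ≤⟨ ≤-scaled ∣ B ∣ 1≤K ⟩
      K * ℕ→ℚ ∣ B ∣  <⟨ K∣B∣<N ⟩
      ℕ→ℚ N          ∎)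

  module _ {B X} (removable : Removable B) (X-contracting : Contracting (G ∖ B) σ D X) where

    private
      ∂B≤D∣B∣ : ℕ→ℚ ∣ boundary G B ∣ ≤ D * ℕ→ℚ ∣ B ∣
      ∂B≤D∣B∣ = proj₁ removable
      K∣B∣<N : K * ℕ→ℚ ∣ B ∣ < ℕ→ℚ N
      K∣B∣<N = proj₂ removable
      X⊆∁B : X ⊆ ∁ B
      X⊆∁B = proj₁ X-contracting
      ∣X∣≤σ : ℕ→ℚ ∣ X ∣ ≤ σ
      ∣X∣≤σ = proj₁ (proj₂ X-contracting)
      shrinks : ℕ→ℚ ∣ nbhd (G ∖ B) X ∣ < D * ℕ→ℚ ∣ X ∣
      shrinks = proj₂ (proj₂ X-contracting)

    ∣B∪X∣≡ : ℕ→ℚ ∣ B ∪ X ∣ ≡ ℕ→ℚ ∣ B ∣ + ℕ→ℚ ∣ X ∣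
    ∣B∪X∣≡ = ≡.trans (cong ℕ→ℚ (∣p∪q∣≡∣p∣+∣q∣ B X X⊆∁B)) (ℕ→ℚ-homo-+ ∣ B ∣ ∣ X ∣)

    boundary-∪-small : ℕ→ℚ ∣ boundary G (B ∪ X) ∣ ≤ D * ℕ→ℚ ∣ B ∪ X ∣
    boundary-∪-small = begin
      ℕ→ℚ ∣ boundary G (B ∪ X) ∣
        ≤⟨ ℕ→ℚ-mono-≤ (ℕP.≤-trans (SP.p⊆q⇒∣p∣≤∣q∣ (boundary-∪ G X⊆∁B))
                                  (∣p∪q∣≤∣p∣+∣q∣ (boundary G B) (nbhd (G ∖ B) X))) ⟩
      ℕ→ℚ (∣ boundary G B ∣ ℕ.+ ∣ nbhd (G ∖ B) X ∣)
        ≡⟨ ℕ→ℚ-homo-+ ∣ boundary G B ∣ ∣ nbhd (G ∖ B) X ∣ ⟩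
      ℕ→ℚ ∣ boundary G B ∣ + ℕ→ℚ ∣ nbhd (G ∖ B) X ∣
        ≤⟨ ℚP.+-mono-≤ ∂B≤D∣B∣ (ℚP.<⇒≤ shrinks) ⟩
      D * ℕ→ℚ ∣ B ∣ + D * ℕ→ℚ ∣ X ∣
        ≡⟨ ℚP.*-distribˡ-+ D _ _ ⟨
      D * (ℕ→ℚ ∣ B ∣ + ℕ→ℚ ∣ X ∣)
        ≡⟨ cong (D *_) ∣B∪X∣≡ ⟨
      D * ℕ→ℚ ∣ B ∪ X ∣
        ∎

    exterior-large : ℕ→ℚ N ≤ ℕ→ℚ 4 * ℕ→ℚ ∣ exterior G (B ∪ X) ∣
    exterior-large = +-cancelˡ-≤ (ℕ→ℚ 3 * #N) (begin
      ℕ→ℚ 3 * #N + #N           ≡⟨ solve 1 (λ n → con (ℕ→ℚ 3) :* n :+ n := con (ℕ→ℚ 4) :* n) refl #N ⟩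
      ℕ→ℚ 4 * #N                ≡⟨ cong (ℕ→ℚ 4 *_) #N≡#R+#Y ⟩
      ℕ→ℚ 4 * (#R + #Y)         ≡⟨ ℚP.*-distribˡ-+ (ℕ→ℚ 4) #R #Y ⟩
      ℕ→ℚ 4 * #R + ℕ→ℚ 4 * #Y   ≤⟨ ℚP.+-monoˡ-≤ (ℕ→ℚ 4 * #Y) 4#R≤3#N ⟩
      ℕ→ℚ 3 * #N + ℕ→ℚ 4 * #Y   ∎)
      where
      S R : Subset N
      S = B ∪ X
      R = S ∪ neighbours (adj G) S
      #N #B #X #S #R #Y : ℚ
      #N = ℕ→ℚ N
      #B = ℕ→ℚ ∣ B ∣
      #X = ℕ→ℚ ∣ X ∣
      #S = ℕ→ℚ ∣ S ∣
      #R = ℕ→ℚ ∣ R ∣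
      #Y = ℕ→ℚ ∣ exterior G S ∣

      #N≡#R+#Y : #N ≡ #R + #Y
      #N≡#R+#Y = ≡.trans (cong ℕ→ℚ (≡.sym (∣p∣+∣∁p∣≡n R))) (ℕ→ℚ-homo-+ ∣ R ∣ ∣ exterior G S ∣)

      #R≤#S+#∂S : #R ≤ #S + ℕ→ℚ ∣ boundary G S ∣
      #R≤#S+#∂S = ℚP.≤-trans
        (ℕ→ℚ-mono-≤ (ℕP.≤-trans (SP.p⊆q⇒∣p∣≤∣q∣ (∪-neighbours⊆∪-boundary G S)) (∣p∪q∣≤∣p∣+∣q∣ S (boundary G S))))
        (ℚP.≤-reflexive (ℕ→ℚ-homo-+ ∣ S ∣ ∣ boundary G S ∣))

      2[D+1]#X≤#N : ℕ→ℚ 2 * (D + 1ℚ) * #X ≤ #N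
      2[D+1]#X≤#N = ℚP.≤-trans (ℚP.*-monoˡ-≤-nonNeg (ℕ→ℚ 2 * (D + 1ℚ)) ∣X∣≤σ) σ-small

      4#R≤3#N : ℕ→ℚ 4 * #R ≤ ℕ→ℚ 3 * #N
      4#R≤3#N = begin
        ℕ→ℚ 4 * #R
          ≤⟨ ℚP.*-monoˡ-≤-nonNeg (ℕ→ℚ 4) (ℚP.≤-trans #R≤#S+#∂S (ℚP.+-monoʳ-≤ #S boundary-∪-small)) ⟩
        ℕ→ℚ 4 * (#S + D * #S)
          ≡⟨ cong (λ s → ℕ→ℚ 4 * (s + D * s)) ∣B∪X∣≡ ⟩
        ℕ→ℚ 4 * ((#B + #X) + D * (#B + #X))
          ≡⟨ solve 3 (λ D b x → con (ℕ→ℚ 4) :* ((b :+ x) :+ D :* (b :+ x))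
                                := con (ℕ→ℚ 4) :* (D :+ con 1ℚ) :* b
                                   :+ con (ℕ→ℚ 2) :* (con (ℕ→ℚ 2) :* (D :+ con 1ℚ) :* x)) refl D #B #X ⟩
        K * #B + ℕ→ℚ 2 * (ℕ→ℚ 2 * (D + 1ℚ) * #X)
          ≤⟨ ℚP.+-mono-≤ (ℚP.<⇒≤ K∣B∣<N) (ℚP.*-monoˡ-≤-nonNeg (ℕ→ℚ 2) 2[D+1]#X≤#N) ⟩
        #N + ℕ→ℚ 2 * #N
          ≡⟨ solve 1 (λ n → n :+ con (ℕ→ℚ 2) :* n := con (ℕ→ℚ 3) :* n) refl #N ⟩
        ℕ→ℚ 3 * #N
          ∎

    removable-∪ : Removable (B ∪ X)
    removable-∪ = boundary-∪-small , K∣S∣<N (ℕP.≤-total ∣ S ∣ ∣ Y ∣)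
      where
      S Y : Subset N
      S = B ∪ X
      Y = exterior G S
      K∣S∣<N : ∣ S ∣ ℕ.≤ ∣ Y ∣ ⊎ ∣ Y ∣ ℕ.≤ ∣ S ∣ → K * ℕ→ℚ ∣ S ∣ < ℕ→ℚ N
      K∣S∣<N (inj₁ ∣S∣≤∣Y∣) = edgeless-small (exterior-disjoint G S) (exterior-edgeless G S) ℕP.≤-refl ∣S∣≤∣Y∣
      K∣S∣<N (inj₂ ∣Y∣≤∣S∣) = contradiction
        (edgeless-small (exterior-disjoint G S) (exterior-edgeless G S) ∣Y∣≤∣S∣ ℕP.≤-refl)
        (≤⇒≯ (ℚP.≤-trans exterior-large (ℚP.*-monoʳ-≤-nonNeg (ℕ→ℚ ∣ Y ∣) {{ℕ→ℚ-nonNegative ∣ Y ∣}} 4≤K)))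

  removable-grows : ∀ {B} → Removable B → ExpandsUpTo (G ∖ B) σ D ⊎ ∃[ B′ ] B ⊂ B′ × Removable B′
  removable-grows {B} removable = map₂ absorb (expands-or-contracting (G ∖ B) σ D)
    where
    absorb : ∃ (Contracting (G ∖ B) σ D) → ∃[ B′ ] B ⊂ B′ × Removable B′
    absorb (X , X-contracting@(X⊆∁B , _)) =
      B ∪ X , p⊂p∪q X⊆∁B (contracting-nonempty (G ∖ B) D X-contracting) , removable-∪ removable X-contracting

  expanding-subgraph : Σ (Subgraph G) (λ H → Nonempty (W H) × ExpandsUpTo H σ D)
  expanding-subgraph =
    let B , removable , expands = grow-until removable-grows removable-⊥
    in G ∖ B , removable⇒∁-nonempty removable , expands

4[D+1]θ<4[D+2]θ : ∀ D {θ} → 0ℚ < θ → ℕ→ℚ 4 * (D + 1ℚ) * θ < ℕ→ℚ 4 * (D + ℕ→ℚ 2) * θ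
4[D+1]θ<4[D+2]θ D {θ} 0<θ = begin-strict
  ℕ→ℚ 4 * (D + 1ℚ) * θ               ≡⟨ ℚP.+-identityʳ _ ⟨
  ℕ→ℚ 4 * (D + 1ℚ) * θ + 0ℚ          <⟨ ℚP.+-monoʳ-< (ℕ→ℚ 4 * (D + 1ℚ) * θ) 0<4θ ⟩
  ℕ→ℚ 4 * (D + 1ℚ) * θ + ℕ→ℚ 4 * θ   ≡⟨ solve 2 (λ D θ → con (ℕ→ℚ 4) :* (D :+ con 1ℚ) :* θ :+ con (ℕ→ℚ 4) :* θ
                                                      := con (ℕ→ℚ 4) :* (D :+ con (ℕ→ℚ 2)) :* θ) refl D θ ⟩
  ℕ→ℚ 4 * (D + ℕ→ℚ 2) * θ            ∎
  where
  open ℚP.≤-Reasoning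
  open +-*-Solver
  0<4θ : 0ℚ < ℕ→ℚ 4 * θ
  0<4θ = ℚP.positive⁻¹ _ {{ℚP.pos*pos⇒pos (ℕ→ℚ 4) θ {{positive 0<θ}}}}

2[D+1]f[n∸1]≤an : ∀ {D f a} n → 0ℚ ≤ D → 0ℚ ≤ f → ℕ→ℚ 2 * (D + 1ℚ) * f ≤ a →
  ℕ→ℚ 2 * (D + 1ℚ) * (f * ℕ→ℚ (n ℕ.∸ 1)) ≤ a * ℕ→ℚ n
2[D+1]f[n∸1]≤an {D} {f} {a} n 0≤D 0≤f 2[D+1]f≤a = begin
  ℕ→ℚ 2 * (D + 1ℚ) * (f * ℕ→ℚ (n ℕ.∸ 1))  ≤⟨ ℚP.*-monoˡ-≤-nonNeg (ℕ→ℚ 2 * (D + 1ℚ))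
                                                (ℚP.*-monoˡ-≤-nonNeg f (ℕ→ℚ-mono-≤ (ℕP.m∸n≤m n 1))) ⟩
  ℕ→ℚ 2 * (D + 1ℚ) * (f * ℕ→ℚ n)          ≡⟨ ℚP.*-assoc (ℕ→ℚ 2 * (D + 1ℚ)) f (ℕ→ℚ n) ⟨
  ℕ→ℚ 2 * (D + 1ℚ) * f * ℕ→ℚ n            ≤⟨ ℚP.*-monoʳ-≤-nonNeg (ℕ→ℚ n) {{ℕ→ℚ-nonNegative n}} 2[D+1]f≤a ⟩
  a * ℕ→ℚ n                               ∎
  where
  open ℚP.≤-Reasoning
  instance
    f-nonNeg : NonNegative f
    f-nonNeg = nonNegative 0≤f
    2[D+1]-nonNeg : NonNegative (ℕ→ℚ 2 * (D + 1ℚ))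
    2[D+1]-nonNeg = ℚP.nonNeg*nonNeg⇒nonNeg (ℕ→ℚ 2) (D + 1ℚ) {{ℚP.nonNeg+nonNeg⇒nonNeg D {{nonNegative 0≤D}} 1ℚ}}

lemma3p6 : (n : ℕ) → n ≥ 1 →
    (f θ D c a : ℚ) → 0ℚ < f → 0ℚ < θ → 0ℚ < D →
    1ℚ ≤ c → ℕ→ℚ 4 * (D + ℕ→ℚ 2) * θ ≤ c →
    ℕ→ℚ 2 * (D + 1ℚ) * f ≤ a →
    (N : ℕ) → a * ℕ→ℚ n ≡ ℕ→ℚ N →
    (p : ℚ) → p * (a * ℕ→ℚ n) ≡ c →
    (G : Graph N) → Bijumbled G p θ →
    Σ (Subgraph G) (λ H → Nonempty (W H) × Expanding H n f D)
lemma3p6 n _ f θ D c a 0<f 0<θ 0<D 1≤c 4[D+2]θ≤c 2[D+1]f≤a N an≡N p pan≡c G bij =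
  Peeling.expanding-subgraph G p θ D (f * ℕ→ℚ (n ℕ.∸ 1)) bij (ℚP.<⇒≤ 0<θ) (ℚP.<⇒≤ 0<D)
    (ℚP.≤-trans 1≤c c≤pN)
    (ℚP.<-≤-trans (4[D+1]θ<4[D+2]θ D 0<θ) (ℚP.≤-trans 4[D+2]θ≤c c≤pN))
    (ℚP.≤-trans (2[D+1]f[n∸1]≤an n (ℚP.<⇒≤ 0<D) (ℚP.<⇒≤ 0<f) 2[D+1]f≤a) (ℚP.≤-reflexive an≡N))
  where
  c≤pN : c ≤ p * ℕ→ℚ N
  c≤pN = ℚP.≤-reflexive (≡.trans (≡.sym pan≡c) (cong (p *_) an≡N))
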